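{- Let $n\ge 1$, let $t_1,\dots,t_n$ be nonnegative integers, and let $b_1,\dots,b_n$ be positive integers satisfying $2b_k\le\sum_{i=1}^n b_i$ for every $k$. Then $$P(t_1,t_2,\ldots,t_n)\le P(t_1+b_1,t_2+b_2,\ldots,t_n+b_n).$$
   Context: For pairwise disjoint finite sets $T_1,\dots,T_n$ with $|T_i|=t_i$, a generalized derangement (GD) is a permutation $\sigma$ of $\bigcup_{i=1}^n T_i$ such that $\sigma(a)\notin T_i$ for every $i$ and every $a\in T_i$. $P(t_1,\dots,t_n)$ denotes the number of GDs; it depends only on the sizes $t_i$. -}

module Defs where

open import Data.Nat using (ℕ; zero; suc)
open import Data.Fin using (Fin; _≟_)
open import Data.Fin.Properties using (all?)
open import Data.List using (List; []; _∷_; [_]; length; concatMap; replicate; allFin; map; filter; lookup)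
open import Data.Vec using (Vec; []; _∷_)
import Data.Vec as Vec
open import Data.Product using (_×_)
open import Relation.Nullary using (¬_; ¬?; _×-dec_; _→-dec_)
open import Relation.Binary.PropositionalEquality using (_≡_)
open import Function.Definitions using (Injective)
open import Relation.Nullary.Decidable using (map′)
open import Data.Nat.ListAction using (sum)

-- Blocks T_1,...,T_n realised concretely: the ground set is Fin (size t),
-- and element a lies in block  block t a : Fin n.
labels : (n : ℕ) → (Fin n → ℕ) → List (Fin n)
labels n t = concatMap (λ i → replicate (t i) i) (allFin n)

size : {n : ℕ} → (Fin n → ℕ) → ℕ
size {n} t = length (labels n t)

block : {n : ℕ} (t : Fin n → ℕ) → Fin (size t) → Fin n
block {n} t a = lookup (labels n t) a

-- A generalized derangement: a permutation (injective self-map of the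
-- finite ground set) sending no element into its own block.
IsGD : {n : ℕ} (t : Fin n → ℕ) → (Fin (size t) → Fin (size t)) → Set
IsGD t σ = Injective _≡_ _≡_ σ × (∀ a → ¬ (block t (σ a) ≡ block t a))

isGD? : {n : ℕ} (t : Fin n → ℕ) (σ : Fin (size t) → Fin (size t)) → Relation.Nullary.Dec (IsGD t σ)
isGD? t σ =
  map′ (λ h {i} {j} → h i j) (λ h i j → h {i} {j})
       (all? (λ i → all? (λ j → (σ i ≟ σ j) →-dec (i ≟ j))))
  ×-dec all? (λ a → ¬? (block t (σ a) ≟ block t a))

-- All functions Fin m → Fin k, as vectors of values (each exactly once).
allVecs : (m k : ℕ) → List (Vec (Fin k) m)
allVecs zero    k = [ [] ]
allVecs (suc m) k = concatMap (λ v → map (λ x → x ∷ v) (allFin k)) (allVecs m k)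

P : {n : ℕ} → (Fin n → ℕ) → ℕ
P t = length (filter (λ v → isGD? t (Vec.lookup v)) (allVecs (size t) (size t)))

sumF : {n : ℕ} → (Fin n → ℕ) → ℕ
sumF {n} b = sum (map b (allFin n))

module Submission where

-- The hypothesis on b makes the blocks of sizes b alone admit a GD τ: write
-- their labels in runs, let m = max b and rotate all positions cyclically
-- by m; equal labels lie fewer than m apart and 2m ≤ Σ b, so every point
-- leaves its block.  The label list of t + b is a permutation of the label
-- list of t followed by that of b, so every GD σ of t yields the GD σ ⊎ τ
-- of t + b, injectively in σ.

open import Defs
open import Data.Nat using (ℕ; _+_; _*_; _≤_)
open import Data.Fin using (Fin)

open import Algebra.Properties.CommutativeSemigroup using (xy∙z≈xz∙y)
open import Data.Empty using (⊥; ⊥-elim)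
open import Data.Fin.Base using (zero; suc; toℕ; fromℕ<; cast; join)
open import Data.Fin.Properties using (+↔⊎; cast-is-id; injective⇒≤; toℕ<n; toℕ-fromℕ<; toℕ-injective)
import Data.Fin.Permutation as FinPerm
open import Data.List using (List; []; _∷_; _++_; length; lookup; map; filter; replicate; concatMap; cartesianProductWith; allFin)
open import Data.List.Extrema using (argmax; f[xs]≤f[argmax])
open import Data.List.Membership.Propositional using (_∈_)
open import Data.List.Membership.Propositional.Properties using (∈-lookup; ∈-map⁻; ∈-filter⁺; ∈-filter⁻; ∈-cartesianProductWith⁺; ∈-allFin)
open import Data.List.Membership.Setoid.Properties using (index-injective)
open import Data.List.Properties using (length-++; length-map; length-replicate; ++-assoc)
open import Data.List.Relation.Binary.Permutation.Homogeneous using (onIndices)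
import Data.List.Relation.Binary.Permutation.Propositional as ↭
open import Data.List.Relation.Binary.Permutation.Propositional.Properties using (++⁺ˡ; shifts)
open import Data.List.Relation.Binary.Permutation.Setoid.Properties using (onIndices-lookup)
open import Data.List.Relation.Binary.Subset.Propositional using (_⊆_)
open import Data.List.Relation.Unary.All as All using ([])
open import Data.List.Relation.Unary.Any using (here)
open import Data.List.Relation.Unary.Unique.Propositional using (Unique; []; _∷_)
import Data.List.Relation.Unary.Unique.Propositional.Properties as Unique
open import Data.Nat using (zero; suc; _∸_; _<_; _<?_; z≤n; z<s; s<s)
open import Data.Nat.ListAction using (sum)
open import Data.Nat.Properties
  using ( module ≤-Reasoning; ≤-totalOrder; +-commutativeSemigroup; +-comm; +-assoc; +-identityʳ
        ; +-cancelʳ-≡; +-mono-≤; +-mono-<-≤; +-monoˡ-≤; +-monoʳ-≤; +-monoˡ-<; +-monoʳ-<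
        ; ∸-monoˡ-<; m+n∸n≡m; m∸n+n≡m; m≤n+m; m+n≤o⇒m≤o; ≮⇒≥; <-irrefl)
open import Data.Product using (_×_; _,_; proj₂; swap; ∃-syntax)
import Data.Product as Product
open import Data.Sum using (_⊎_; inj₁; inj₂; [_,_]′)
import Data.Sum as Sum
open import Data.Sum.Properties using (inj₁-injective; inj₂-injective)
open import Data.Vec using (Vec; []; _∷_)
import Data.Vec as Vec
open import Data.Vec.Properties using (∷-injective; lookup∘tabulate; tabulate∘lookup; tabulate-cong)
open import Function using (_∘_; _↔_; Inverse)
open import Function.Construct.Composition using (_↔-∘_)
open import Function.Construct.Symmetry using (↔-sym)
open import Function.Definitions using (Injective)
open import Level using (0ℓ)
open import Relation.Binary.PropositionalEquality
open import Relation.Nullary using (yes; no)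
open import Relation.Unary using (Pred; Decidable)

module _ {X A : Set} where

  IsDerangement : (X → A) → (X → X) → Set
  IsDerangement ℓ σ = Injective _≡_ _≡_ σ × (∀ x → ℓ (σ x) ≢ ℓ x)

  derangement-cong : {ℓ : X → A} {σ σ′ : X → X} → σ ≗ σ′ → IsDerangement ℓ σ → IsDerangement ℓ σ′
  derangement-cong {ℓ} σ≗σ′ (inj , moves) =
    (λ {x} {y} e → inj (trans (σ≗σ′ x) (trans e (sym (σ≗σ′ y))))) ,
    (λ x e → moves x (trans (cong ℓ (σ≗σ′ x)) e))

⊎-derangement : {X Y A : Set} {ℓ₁ : X → A} {ℓ₂ : Y → A} {σ : X → X} {τ : Y → Y}
  → IsDerangement ℓ₁ σ → IsDerangement ℓ₂ τ → IsDerangement [ ℓ₁ , ℓ₂ ]′ (Sum.map σ τ)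
⊎-derangement {ℓ₁ = ℓ₁} {ℓ₂} {σ} {τ} (σ-inj , σ-moves) (τ-inj , τ-moves) = inj , moves
  where
  inj : Injective _≡_ _≡_ (Sum.map σ τ)
  inj {inj₁ x} {inj₁ y} e = cong inj₁ (σ-inj (inj₁-injective e))
  inj {inj₂ x} {inj₂ y} e = cong inj₂ (τ-inj (inj₂-injective e))
  inj {inj₁ x} {inj₂ y} ()
  inj {inj₂ x} {inj₁ y} ()
  moves : ∀ s → [ ℓ₁ , ℓ₂ ]′ (Sum.map σ τ s) ≢ [ ℓ₁ , ℓ₂ ]′ s
  moves (inj₁ x) = σ-moves x
  moves (inj₂ y) = τ-moves y

record Relabelling {X Y A : Set} (ℓ : X → A) (ℓ′ : Y → A) : Set where
  field
    bijection : X ↔ Y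
  open Inverse bijection public using (to; from; strictlyInverseˡ; strictlyInverseʳ)
  field
    preserves : ∀ x → ℓ′ (to x) ≡ ℓ x

  conjugate : (X → X) → (Y → Y)
  conjugate σ = to ∘ σ ∘ from

  conjugate-derangement : {σ : X → X} → IsDerangement ℓ σ → IsDerangement ℓ′ (conjugate σ)
  conjugate-derangement {σ} (σ-inj , σ-moves) = inj , moves
    where
    inj : Injective _≡_ _≡_ (conjugate σ)
    inj {y} {y′} e = begin
      y                ≡⟨ strictlyInverseˡ y ⟨
      to (from y)      ≡⟨ cong to (σ-inj (to-injective e)) ⟩
      to (from y′)     ≡⟨ strictlyInverseˡ y′ ⟩
      y′               ∎
      where open ≡-Reasoning
            to-injective : ∀ {x x′} → to x ≡ to x′ → x ≡ x′
            to-injective {x} {x′} e = trans (sym (strictlyInverseʳ x)) (trans (cong from e) (strictlyInverseʳ x′))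
    moves : ∀ y → ℓ′ (conjugate σ y) ≢ ℓ′ y
    moves y e = σ-moves (from y) (begin
      ℓ (σ (from y))        ≡⟨ preserves (σ (from y)) ⟨
      ℓ′ (conjugate σ y)    ≡⟨ e ⟩
      ℓ′ y                  ≡⟨ cong ℓ′ (strictlyInverseˡ y) ⟨
      ℓ′ (to (from y))      ≡⟨ preserves (from y) ⟩
      ℓ (from y)            ∎)
      where open ≡-Reasoning

  conjugate-injective : {σ σ′ : X → X} → conjugate σ ≗ conjugate σ′ → σ ≗ σ′
  conjugate-injective {σ} {σ′} e x = begin
    σ x                          ≡⟨ unconjugate σ ⟨
    from (conjugate σ (to x))    ≡⟨ cong from (e (to x)) ⟩
    from (conjugate σ′ (to x))   ≡⟨ unconjugate σ′ ⟩
    σ′ x                         ∎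
    where
    open ≡-Reasoning
    unconjugate : ∀ ρ → from (conjugate ρ (to x)) ≡ ρ x
    unconjugate ρ = trans (strictlyInverseʳ _) (cong ρ (strictlyInverseʳ x))

_⨾_ : {X Y Z A : Set} {ℓ : X → A} {ℓ′ : Y → A} {ℓ″ : Z → A}
  → Relabelling ℓ ℓ′ → Relabelling ℓ′ ℓ″ → Relabelling ℓ ℓ″
r ⨾ r′ = record
  { bijection = Relabelling.bijection r′ ↔-∘ Relabelling.bijection r
  ; preserves = λ x → trans (Relabelling.preserves r′ _) (Relabelling.preserves r x)
  }

↭-relabelling : {A : Set} {xs ys : List A} → xs ↭.↭ ys → Relabelling (lookup xs) (lookup ys)
↭-relabelling {A} p = record
  { bijection = onIndices p′
  ; preserves = λ i → sym (onIndices-lookup (setoid A) p′ i)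
  }
  where p′ = ↭.↭⇒↭ₛ p

lookup-++ : {A : Set} (L M : List A) (s : Fin (length L) ⊎ Fin (length M))
  → lookup (L ++ M) (cast (sym (length-++ L)) (join (length L) (length M) s)) ≡ [ lookup L , lookup M ]′ s
lookup-++ []      M (inj₂ j)       = cong (lookup M) (cast-is-id _ j)
lookup-++ (x ∷ L) M (inj₁ zero)    = refl
lookup-++ (x ∷ L) M (inj₁ (suc i)) = lookup-++ L M (inj₁ i)
lookup-++ (x ∷ L) M (inj₂ j)       = lookup-++ L M (inj₂ j)

++-relabelling : {A : Set} (L M : List A) → Relabelling [ lookup L , lookup M ]′ (lookup (L ++ M))
++-relabelling L M = record
  { bijection = FinPerm.cast-id (sym (length-++ L)) ↔-∘ ↔-sym +↔⊎
  ; preserves = lookup-++ L M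
  }

module _ {X : Set} where

  lookup-injective : {xs : List X} → Unique xs → Injective _≡_ _≡_ (lookup xs)
  lookup-injective (_ ∷ _) {zero} {zero} _ = refl
  lookup-injective (x∉xs ∷ _) {zero} {suc j} e = ⊥-elim (All.lookup x∉xs (∈-lookup j) e)
  lookup-injective (x∉xs ∷ _) {suc i} {zero} e = ⊥-elim (All.lookup x∉xs (∈-lookup i) (sym e))
  lookup-injective (_ ∷ u) {suc i} {suc j} e = cong suc (lookup-injective u e)

  unique-⊆⇒length≤ : {xs ys : List X} → Unique xs → xs ⊆ ys → length xs ≤ length ys
  unique-⊆⇒length≤ u xs⊆ys =
    injective⇒≤ (λ e → lookup-injective u (index-injective (setoid X) (xs⊆ys (∈-lookup _)) (xs⊆ys (∈-lookup _)) e))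

count-mono : {X Y : Set} {P : Pred X 0ℓ} {Q : Pred Y 0ℓ} (P? : Decidable P) (Q? : Decidable Q)
  (F : X → Y) → Injective _≡_ _≡_ F → (∀ x → P x → Q (F x))
  → {xs : List X} {ys : List Y} → Unique xs → (∀ y → y ∈ ys)
  → length (filter P? xs) ≤ length (filter Q? ys)
count-mono P? Q? F F-inj P⇒Q {xs} {ys} u complete = begin
  length (filter P? xs)          ≡⟨ length-map F (filter P? xs) ⟨
  length (map F (filter P? xs))  ≤⟨ unique-⊆⇒length≤ (Unique.map⁺ F-inj (Unique.filter⁺ P? u)) image⊆ ⟩
  length (filter Q? ys)          ∎
  where
  open ≤-Reasoning
  image⊆ : map F (filter P? xs) ⊆ filter Q? ys
  image⊆ z∈ with _ , x∈ , refl ← ∈-map⁻ F z∈ = ∈-filter⁺ Q? (complete _) (P⇒Q _ (proj₂ (∈-filter⁻ P? {xs = xs} x∈)))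

-- allVecs is built by concatMap; the library's uniqueness and membership
-- facts are stated for cartesianProductWith, which is the same list.
concatMap-map≡cartesianProductWith : {X Y Z : Set} (f : X → Y → Z) (xs : List X) (ys : List Y)
  → concatMap (λ x → map (f x) ys) xs ≡ cartesianProductWith f xs ys
concatMap-map≡cartesianProductWith f []       ys = refl
concatMap-map≡cartesianProductWith f (x ∷ xs) ys = cong (map (f x) ys ++_) (concatMap-map≡cartesianProductWith f xs ys)

module _ (k : ℕ) where

  allVecs-suc : ∀ m → allVecs (suc m) k ≡ cartesianProductWith (λ v x → x ∷ v) (allVecs m k) (allFin k)
  allVecs-suc m = concatMap-map≡cartesianProductWith (λ v x → x ∷ v) (allVecs m k) (allFin k)

  allVecs-unique : ∀ m → Unique (allVecs m k)
  allVecs-unique zero    = [] ∷ []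
  allVecs-unique (suc m) rewrite allVecs-suc m =
    Unique.cartesianProductWith⁺ (λ v x → x ∷ v) (λ e → swap (∷-injective e)) (allVecs-unique m) (Unique.allFin⁺ k)

  allVecs-complete : ∀ m (v : Vec (Fin k) m) → v ∈ allVecs m k
  allVecs-complete zero    []      = here refl
  allVecs-complete (suc m) (x ∷ v) rewrite allVecs-suc m =
    ∈-cartesianProductWith⁺ (λ v x → x ∷ v) (allVecs-complete m v) (∈-allFin x)

-- P is monotone along any transformation Φ of self-maps that is injective
-- (up to pointwise equality) and carries GDs to GDs: encode self-maps as
-- vectors of values and count along the induced injection.
P-mono : {n n′ : ℕ} {t : Fin n → ℕ} {t′ : Fin n′ → ℕ}
  (Φ : (Fin (size t) → Fin (size t)) → Fin (size t′) → Fin (size t′))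
  → (∀ {σ σ′} → Φ σ ≗ Φ σ′ → σ ≗ σ′) → (∀ {σ} → IsGD t σ → IsGD t′ (Φ σ))
  → P t ≤ P t′
P-mono {t = t} {t′} Φ Φ-injective Φ-GD =
  count-mono (λ v → isGD? t (Vec.lookup v)) (λ v → isGD? t′ (Vec.lookup v)) F F-injective F-GD
    (allVecs-unique (size t) (size t)) (allVecs-complete (size t′) (size t′))
  where
  F : Vec (Fin (size t)) (size t) → Vec (Fin (size t′)) (size t′)
  F v = Vec.tabulate (Φ (Vec.lookup v))
  F-injective : Injective _≡_ _≡_ F
  F-injective {v} {w} e = begin
    v                          ≡⟨ tabulate∘lookup v ⟨
    Vec.tabulate (Vec.lookup v) ≡⟨ tabulate-cong (Φ-injective same-image) ⟩
    Vec.tabulate (Vec.lookup w) ≡⟨ tabulate∘lookup w ⟩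
    w                          ∎
    where
    open ≡-Reasoning
    same-image : Φ (Vec.lookup v) ≗ Φ (Vec.lookup w)
    same-image i = trans (sym (lookup∘tabulate _ i)) (trans (cong (λ u → Vec.lookup u i) e) (lookup∘tabulate _ i))
  F-GD : ∀ v → IsGD t (Vec.lookup v) → IsGD t′ (Vec.lookup (F v))
  F-GD v gd = derangement-cong (λ i → sym (lookup∘tabulate _ i)) (Φ-GD gd)

runs : {X : Set} → (X → ℕ) → List X → List X
runs c xs = concatMap (λ x → replicate (c x) x) xs

replicate-+ : {X : Set} (m n : ℕ) (x : X) → replicate (m + n) x ≡ replicate m x ++ replicate n x
replicate-+ zero    n x = refl
replicate-+ (suc m) n x = cong (x ∷_) (replicate-+ m n x)

runs-+ : {X : Set} (c d : X → ℕ) (xs : List X) → runs (λ x → c x + d x) xs ↭.↭ runs c xs ++ runs d xs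
runs-+ c d []       = ↭.↭-refl
runs-+ c d (x ∷ xs) = begin
  replicate (c x + d x) x ++ runs (λ y → c y + d y) xs  ≡⟨ cong (_++ _) (replicate-+ (c x) (d x) x) ⟩
  (cx ++ dx) ++ runs (λ y → c y + d y) xs               ≡⟨ ++-assoc cx dx _ ⟩
  cx ++ dx ++ runs (λ y → c y + d y) xs                 ↭⟨ ++⁺ˡ cx (++⁺ˡ dx (runs-+ c d xs)) ⟩
  cx ++ dx ++ runs c xs ++ runs d xs                    ↭⟨ ++⁺ˡ cx (shifts dx (runs c xs)) ⟩
  cx ++ runs c xs ++ dx ++ runs d xs                    ≡⟨ ++-assoc cx (runs c xs) _ ⟨
  (cx ++ runs c xs) ++ dx ++ runs d xs                  ∎
  where
  open ↭.PermutationReasoning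
  cx = replicate (c x) x
  dx = replicate (d x) x

-- Positions inside runs are tracked with natural-number indices, which
-- avoids casting between Fin (length (xs ++ ys)) and Fin (length xs + …).

data AtIndex {X : Set} : List X → ℕ → X → Set where
  at-head : ∀ {x xs} → AtIndex (x ∷ xs) 0 x
  at-tail : ∀ {x xs j y} → AtIndex xs j y → AtIndex (x ∷ xs) (suc j) y

module _ {X : Set} where

  at-lookup : (xs : List X) (i : Fin (length xs)) → AtIndex xs (toℕ i) (lookup xs i)
  at-lookup (x ∷ xs) zero    = at-head
  at-lookup (x ∷ xs) (suc i) = at-tail (at-lookup xs i)

  at-++ : (xs : List X) {ys : List X} {j : ℕ} {y : X} → AtIndex (xs ++ ys) j y
    → AtIndex xs j y ⊎ ∃[ k ] (j ≡ length xs + k × AtIndex ys k y)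
  at-++ []       at          = inj₂ (_ , refl , at)
  at-++ (x ∷ xs) at-head     = inj₁ at-head
  at-++ (x ∷ xs) (at-tail at) with at-++ xs at
  ... | inj₁ at′             = inj₁ (at-tail at′)
  ... | inj₂ (k , refl , at′) = inj₂ (k , refl , at′)

  at-replicate : (c : ℕ) (x : X) {j : ℕ} {y : X} → AtIndex (replicate c x) j y → y ≡ x × j < c
  at-replicate (suc c) x at-head      = refl , z<s
  at-replicate (suc c) x (at-tail at) = Product.map₂ s<s (at-replicate c x at)

  runStart : (c : X → ℕ) (xs : List X) → Fin (length xs) → ℕ
  runStart c (x ∷ xs) zero    = 0
  runStart c (x ∷ xs) (suc i) = c x + runStart c xs i

  runs-interval : (c : X → ℕ) (xs : List X) {j : ℕ} {y : X} → AtIndex (runs c xs) j y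
    → ∃[ i ] (lookup xs i ≡ y × runStart c xs i ≤ j × j < runStart c xs i + c y)
  runs-interval c (x ∷ xs) at with at-++ (replicate (c x) x) at
  ... | inj₁ at′ with refl , j<cx ← at-replicate (c x) x at′ = zero , refl , z≤n , j<cx
  runs-interval c (x ∷ xs) at | inj₂ (k , refl , at′)
    with i , refl , lo , hi ← runs-interval c xs at′ = suc i , refl , lo′ , hi′
    where
    open ≤-Reasoning
    |cx|≡cx : length (replicate (c x) x) ≡ c x
    |cx|≡cx = length-replicate (c x)
    lo′ : c x + runStart c xs i ≤ length (replicate (c x) x) + k
    lo′ = begin
      c x + runStart c xs i              ≤⟨ +-monoʳ-≤ (c x) lo ⟩
      c x + k                            ≡⟨ cong (_+ k) |cx|≡cx ⟨
      length (replicate (c x) x) + k     ∎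
    hi′ : length (replicate (c x) x) + k < c x + runStart c xs i + c (lookup xs i)
    hi′ = begin-strict
      length (replicate (c x) x) + k               ≡⟨ cong (_+ k) |cx|≡cx ⟩
      c x + k                                      <⟨ +-monoʳ-< (c x) hi ⟩
      c x + (runStart c xs i + c (lookup xs i))    ≡⟨ +-assoc (c x) _ _ ⟨
      c x + runStart c xs i + c (lookup xs i)      ∎

  length-runs : (c : X → ℕ) (xs : List X) → length (runs c xs) ≡ sum (map c xs)
  length-runs c []       = refl
  length-runs c (x ∷ xs) = trans (length-++ (replicate (c x) x)) (cong₂ _+_ (length-replicate (c x)) (length-runs c xs))

Clustered : {N : ℕ} {A : Set} → ℕ → (Fin N → A) → Set
Clustered m ℓ = ∀ p q → ℓ p ≡ ℓ q → toℕ q < toℕ p + m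

runs-clustered : {X : Set} (c : X → ℕ) {xs : List X} {m : ℕ} → Unique xs → (∀ x → c x ≤ m)
  → Clustered m (lookup (runs c xs))
runs-clustered c {xs} {m} u c≤m p q e
  with i , i↦ , lo , _ ← runs-interval c xs (at-lookup _ p)
     | i′ , i′↦ , _ , hi′ ← runs-interval c xs (at-lookup _ q)
  with refl ← lookup-injective u (trans i↦ (trans e (sym i′↦))) = begin-strict
    toℕ q                                       <⟨ hi′ ⟩
    runStart c xs i + c (lookup (runs c xs) q)  ≤⟨ +-mono-≤ lo (c≤m _) ⟩
    toℕ p + m                                   ∎
  where open ≤-Reasoning

module _ {N m : ℕ} (m≤N : m ≤ N) where

  private
    wrapped<N : (i : Fin N) → N ≤ toℕ i + m → toℕ i + m ∸ N < N
    wrapped<N i N≤i+m = begin-strict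
      toℕ i + m ∸ N   <⟨ ∸-monoˡ-< (+-mono-<-≤ (toℕ<n i) m≤N) N≤i+m ⟩
      N + N ∸ N       ≡⟨ m+n∸n≡m N N ⟩
      N               ∎
      where open ≤-Reasoning

  rotate : Fin N → Fin N
  rotate i with toℕ i + m <? N
  ... | yes fits      = fromℕ< fits
  ... | no  overflows = fromℕ< (wrapped<N i (≮⇒≥ overflows))

  Shifted : ℕ → ℕ → Set
  Shifted r a = r ≡ a + m ⊎ r + N ≡ a + m

  rotate-shifted : ∀ i → Shifted (toℕ (rotate i)) (toℕ i)
  rotate-shifted i with toℕ i + m <? N
  ... | yes fits      = inj₁ (toℕ-fromℕ< fits)
  ... | no  overflows = inj₂ (trans (cong (_+ N) (toℕ-fromℕ< _)) (m∸n+n≡m (≮⇒≥ overflows)))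

  shifted-unique : ∀ {r a b} → a < N → b < N → Shifted r a → Shifted r b → a ≡ b
  shifted-unique _   _   (inj₁ p) (inj₁ q) = +-cancelʳ-≡ m _ _ (trans (sym p) q)
  shifted-unique _   _   (inj₂ p) (inj₂ q) = +-cancelʳ-≡ m _ _ (trans (sym p) q)
  shifted-unique _   b<N (inj₁ p) (inj₂ q) = ⊥-elim (wrap-clash p q b<N)
    where
    wrap-clash : ∀ {r a b} → r ≡ a + m → r + N ≡ b + m → b < N → ⊥
    wrap-clash {r} {a} {b} p q b<N = <-irrefl refl (begin-strict
      b + m          <⟨ +-monoˡ-< m b<N ⟩
      N + m          ≡⟨ +-comm N m ⟩
      m + N          ≤⟨ +-monoˡ-≤ N (m≤n+m m a) ⟩
      a + m + N      ≡⟨ cong (_+ N) p ⟨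
      r + N          ≡⟨ q ⟩
      b + m          ∎)
      where open ≤-Reasoning
  shifted-unique a<N b<N (inj₂ p) (inj₁ q) = sym (shifted-unique b<N a<N (inj₁ q) (inj₂ p))

  rotate-injective : Injective _≡_ _≡_ rotate
  rotate-injective {i} {j} e = toℕ-injective (shifted-unique (toℕ<n i) (toℕ<n j) (rotate-shifted i)
    (subst (λ r → Shifted r (toℕ j)) (cong toℕ (sym e)) (rotate-shifted j)))

-- If 2m ≤ N, rotating by m is a derangement of every m-clustered labelling:
-- an unwrapped point moves exactly m ahead, a wrapped one N - m ≥ m back.
rotate-derangement : {N m : ℕ} {A : Set} {ℓ : Fin N → A} (2m≤N : m + m ≤ N)
  → Clustered m ℓ → IsDerangement ℓ (rotate (m+n≤o⇒m≤o m 2m≤N))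
rotate-derangement {N} {m} {ℓ = ℓ} 2m≤N clustered = rotate-injective m≤N , moves
  where
  m≤N : m ≤ N
  m≤N = m+n≤o⇒m≤o m 2m≤N
  moves : ∀ i → ℓ (rotate m≤N i) ≢ ℓ i
  moves i same-label with rotate-shifted m≤N i
  ... | inj₁ p = <-irrefl p (clustered i (rotate m≤N i) (sym same-label))
  ... | inj₂ q = <-irrefl refl (begin-strict
    toℕ i + N          <⟨ +-monoˡ-< N (clustered (rotate m≤N i) i same-label) ⟩
    r + m + N          ≡⟨ xy∙z≈xz∙y +-commutativeSemigroup r m N ⟩
    r + N + m          ≡⟨ cong (_+ m) q ⟩
    toℕ i + m + m      ≡⟨ +-assoc (toℕ i) m m ⟩
    toℕ i + (m + m)    ≤⟨ +-monoʳ-≤ (toℕ i) 2m≤N ⟩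
    toℕ i + N          ∎)
    where
    open ≤-Reasoning
    r : ℕ
    r = toℕ (rotate m≤N i)

P-adjoin : {n : ℕ} {t t′ : Fin n → ℕ} (M : List (Fin n)) → labels n t′ ↭.↭ labels n t ++ M
  → ∃[ τ ] IsDerangement (lookup M) τ → P t ≤ P t′
P-adjoin {n} {t} {t′} M t′↭t++M (τ , τ-derangement) =
  P-mono adjoin adjoin-injective adjoin-derangement
  where
  relabelling : Relabelling [ lookup (labels n t) , lookup M ]′ (lookup (labels n t′))
  relabelling = ++-relabelling (labels n t) M ⨾ ↭-relabelling (↭.↭-sym t′↭t++M)
  open Relabelling relabelling
  adjoin : (Fin (size t) → Fin (size t)) → Fin (size t′) → Fin (size t′)
  adjoin σ = conjugate (Sum.map σ τ)
  adjoin-injective : ∀ {σ σ′} → adjoin σ ≗ adjoin σ′ → σ ≗ σ′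
  adjoin-injective {σ} {σ′} e x = inj₁-injective (conjugate-injective {Sum.map σ τ} {Sum.map σ′ τ} e (inj₁ x))
  adjoin-derangement : ∀ {σ} → IsGD t σ → IsGD t′ (adjoin σ)
  adjoin-derangement {σ} σ-derangement = conjugate-derangement {Sum.map σ τ} (⊎-derangement σ-derangement τ-derangement)

-- If no block exceeds half the total, the largest block m satisfies the
-- hypotheses of rotate-derangement, so rotation by m is a GD.
labels-derangement : {n : ℕ} (c : Fin (suc n) → ℕ) → (∀ k → 2 * c k ≤ sumF c)
  → ∃[ τ ] IsDerangement (lookup (labels (suc n) c)) τ
labels-derangement {n} c half = _ , rotate-derangement 2m≤N (runs-clustered c (Unique.allFin⁺ (suc n)) c≤m)
  where
  largest : Fin (suc n)
  largest = argmax ≤-totalOrder c zero (allFin (suc n))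
  m : ℕ
  m = c largest
  c≤m : ∀ k → c k ≤ m
  c≤m k = All.lookup (f[xs]≤f[argmax] ≤-totalOrder {f = c} zero (allFin (suc n))) (∈-allFin k)
  2m≤N : m + m ≤ size c
  2m≤N = subst₂ _≤_ (cong (m +_) (+-identityʳ m)) (sym (length-runs c (allFin (suc n)))) (half largest)

theorem4p4 : (n : ℕ) → 1 ≤ n → (t b : Fin n → ℕ)
    → (∀ k → 1 ≤ b k)
    → (∀ k → 2 * b k ≤ sumF b)
    → P t ≤ P (λ i → t i + b i)
theorem4p4 zero    () t b _ half
theorem4p4 (suc n) _  t b _ half =
  P-adjoin {t = t} (labels (suc n) b) (runs-+ t b (allFin (suc n))) (labels-derangement b half)
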